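{- Let $\Gamma$ be a simple connected graph. Suppose $\Gamma$ has two distinct vertices $u,w$ such that $u$ is adjacent to $w$ and $\operatorname{nbd}(u)\cap\operatorname{nbd}(w)=\emptyset$. Then there exists a non-zero $(0,1)$-vector in the row space of the adjacency matrix $A(\Gamma)$ over $\mathbb{R}$ which does not occur as a row of $A(\Gamma)$.
   Context: $\operatorname{nbd}(x)$ denotes the set of vertices adjacent to $x$. The adjacency matrix $A(\Gamma)=(a_{ij})$ has $a_{ij}=1$ if $v_i$ is adjacent to $v_j$ and $0$ otherwise; the row space is over the real numbers. -}

module Defs where

open import Data.Nat using (ℕ; zero; suc)
open import Data.Fin using (Fin; zero; suc)
open import Data.Bool using (Bool; true; false)
open import Data.Rational using (ℚ; 0ℚ; 1ℚ; _+_; _*_)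
open import Data.Product using (_×_; ∃)
open import Relation.Binary.PropositionalEquality using (_≡_)
open import Relation.Nullary using (¬_)

record SimpleGraph (n : ℕ) : Set where
  field
    adjacent   : Fin n → Fin n → Bool
    symmetric  : ∀ x y → adjacent x y ≡ adjacent y x
    irreflexive : ∀ x → adjacent x x ≡ false
open SimpleGraph public

data Reachable {n : ℕ} (Γ : SimpleGraph n) : Fin n → Fin n → Set where
  here : ∀ {x} → Reachable Γ x x
  step : ∀ {x y z} → adjacent Γ x y ≡ true → Reachable Γ y z → Reachable Γ x z

Connected : ∀ {n} → SimpleGraph n → Set
Connected {n} Γ = ∀ (x y : Fin n) → Reachable Γ x y

DisjointNbds : ∀ {n} → SimpleGraph n → Fin n → Fin n → Set
DisjointNbds {n} Γ u w = ∀ (x : Fin n) → ¬ (adjacent Γ u x ≡ true × adjacent Γ w x ≡ true)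

toℚ : Bool → ℚ
toℚ true  = 1ℚ
toℚ false = 0ℚ

sumFin : ∀ {n} → (Fin n → ℚ) → ℚ
sumFin {zero}  f = 0ℚ
sumFin {suc n} f = f zero + sumFin (λ i → f (suc i))

adjMatrix : ∀ {n} → SimpleGraph n → Fin n → Fin n → ℚ
adjMatrix Γ i j = toℚ (adjacent Γ i j)

InRowSpace : ∀ {n} → SimpleGraph n → (Fin n → ℚ) → Set
InRowSpace {n} Γ v = ∃ λ (c : Fin n → ℚ) → ∀ (j : Fin n) → v j ≡ sumFin (λ i → c i * adjMatrix Γ i j)

IsRow : ∀ {n} → SimpleGraph n → (Fin n → Bool) → Set
IsRow {n} Γ v = ∃ λ (i : Fin n) → ∀ (j : Fin n) → v j ≡ adjacent Γ i j

{-# OPTIONS --safe #-}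
module Submission where

-- The sum of the rows of u and w is the indicator vector of nbd(u) ∪ nbd(w); it is a
-- (0,1)-vector because the two neighbourhoods are disjoint. It contains u and w, since
-- u ~ w. A vertex whose row equals it would be adjacent to both u and w, i.e. a common
-- neighbour, which disjointness forbids.

open import Defs
open import Algebra.Bundles using (CommutativeMonoid)
open import Data.Nat using (ℕ; zero; suc)
open import Data.Fin using (Fin; zero; suc)
open import Data.Bool using (Bool; true; false; _∨_)
open import Data.Bool.Properties using (∨-zeroʳ)
open import Data.Product using (_×_; ∃; _,_)
open import Data.Rational using (ℚ; 0ℚ; 1ℚ; _+_; _*_)
open import Data.Rational.Properties
  using (+-identityˡ; +-identityʳ; *-zeroˡ; *-identityˡ; *-distribʳ-+; +-0-commutativeMonoid)
open import Algebra.Properties.CommutativeSemigroup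
  (CommutativeMonoid.commutativeSemigroup +-0-commutativeMonoid) using (interchange)
open import Data.Empty using (⊥-elim)
open import Relation.Binary.PropositionalEquality
  using (_≡_; _≢_; refl; sym; trans; cong; cong₂; module ≡-Reasoning)
open import Relation.Nullary using (¬_)

sumFin-zero : ∀ {n} (f : Fin n → ℚ) → (∀ i → f i ≡ 0ℚ) → sumFin f ≡ 0ℚ
sumFin-zero {zero}  f f≡0 = refl
sumFin-zero {suc n} f f≡0 =
  cong₂ _+_ (f≡0 zero) (sumFin-zero (λ i → f (suc i)) (λ i → f≡0 (suc i)))

sumFin-cong : ∀ {n} {f g : Fin n → ℚ} → (∀ i → f i ≡ g i) → sumFin f ≡ sumFin g
sumFin-cong {zero}  f≡g = refl
sumFin-cong {suc n} f≡g = cong₂ _+_ (f≡g zero) (sumFin-cong (λ i → f≡g (suc i)))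

sumFin-+ : ∀ {n} (f g : Fin n → ℚ) → sumFin (λ i → f i + g i) ≡ sumFin f + sumFin g
sumFin-+ {zero}  f g = refl
sumFin-+ {suc n} f g = begin
  (f zero + g zero) + sumFin (λ i → f (suc i) + g (suc i))
    ≡⟨ cong ((f zero + g zero) +_) (sumFin-+ (λ i → f (suc i)) (λ i → g (suc i))) ⟩
  (f zero + g zero) + (sumFin (λ i → f (suc i)) + sumFin (λ i → g (suc i)))
    ≡⟨ interchange (f zero) (g zero) _ _ ⟩
  (f zero + sumFin (λ i → f (suc i))) + (g zero + sumFin (λ i → g (suc i))) ∎
  where open ≡-Reasoning

δ : ∀ {n} → Fin n → Fin n → ℚ
δ zero    zero    = 1ℚ
δ zero    (suc i) = 0ℚ
δ (suc u) zero    = 0ℚ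
δ (suc u) (suc i) = δ u i

sumFin-δ : ∀ {n} (u : Fin n) (f : Fin n → ℚ) → sumFin (λ i → δ u i * f i) ≡ f u
sumFin-δ zero f = begin
  1ℚ * f zero + sumFin (λ i → 0ℚ * f (suc i))
    ≡⟨ cong₂ _+_ (*-identityˡ (f zero)) (sumFin-zero _ (λ i → *-zeroˡ (f (suc i)))) ⟩
  f zero + 0ℚ
    ≡⟨ +-identityʳ (f zero) ⟩
  f zero ∎
  where open ≡-Reasoning
sumFin-δ (suc u) f = begin
  0ℚ * f zero + sumFin (λ i → δ u i * f (suc i))
    ≡⟨ cong₂ _+_ (*-zeroˡ (f zero)) (sumFin-δ u (λ i → f (suc i))) ⟩
  0ℚ + f (suc u)
    ≡⟨ +-identityˡ (f (suc u)) ⟩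
  f (suc u) ∎
  where open ≡-Reasoning

module _ {n} (Γ : SimpleGraph n) where

  InRowSpace-resp : ∀ {v v′ : Fin n → ℚ} → (∀ j → v j ≡ v′ j) → InRowSpace Γ v → InRowSpace Γ v′
  InRowSpace-resp v≡v′ (c , v≡cA) = c , λ j → trans (sym (v≡v′ j)) (v≡cA j)

  row∈RowSpace : ∀ (u : Fin n) → InRowSpace Γ (adjMatrix Γ u)
  row∈RowSpace u = δ u , λ j → sym (sumFin-δ u (λ i → adjMatrix Γ i j))

  InRowSpace-+ : ∀ {v v′ : Fin n → ℚ} → InRowSpace Γ v → InRowSpace Γ v′ →
                 InRowSpace Γ (λ j → v j + v′ j)
  InRowSpace-+ {v} {v′} (c , v≡cA) (c′ , v′≡c′A) = (λ i → c i + c′ i) , λ j → begin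
    v j + v′ j
      ≡⟨ cong₂ _+_ (v≡cA j) (v′≡c′A j) ⟩
    sumFin (λ i → c i * adjMatrix Γ i j) + sumFin (λ i → c′ i * adjMatrix Γ i j)
      ≡⟨ sym (sumFin-+ (λ i → c i * adjMatrix Γ i j) (λ i → c′ i * adjMatrix Γ i j)) ⟩
    sumFin (λ i → c i * adjMatrix Γ i j + c′ i * adjMatrix Γ i j)
      ≡⟨ sumFin-cong (λ i → sym (*-distribʳ-+ (adjMatrix Γ i j) (c i) (c′ i))) ⟩
    sumFin (λ i → (c i + c′ i) * adjMatrix Γ i j) ∎
    where open ≡-Reasoning

toℚ-∨ : ∀ (a b : Bool) → ¬ (a ≡ true × b ≡ true) → toℚ (a ∨ b) ≡ toℚ a + toℚ b
toℚ-∨ true  true  ¬both = ⊥-elim (¬both (refl , refl))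
toℚ-∨ true  false ¬both = sym (+-identityʳ 1ℚ)
toℚ-∨ false b     ¬both = sym (+-identityˡ (toℚ b))

module _ {n} (Γ : SimpleGraph n) (u w : Fin n) where

  nbdUnion : Fin n → Bool
  nbdUnion j = adjacent Γ u j ∨ adjacent Γ w j

  nbdUnion∈RowSpace : DisjointNbds Γ u w → InRowSpace Γ (λ j → toℚ (nbdUnion j))
  nbdUnion∈RowSpace disjoint =
    InRowSpace-resp Γ (λ j → sym (toℚ-∨ (adjacent Γ u j) (adjacent Γ w j) (disjoint j)))
      (InRowSpace-+ Γ (row∈RowSpace Γ u) (row∈RowSpace Γ w))

  module _ (u~w : adjacent Γ u w ≡ true) where

    nbdUnion-w : nbdUnion w ≡ true
    nbdUnion-w = cong (_∨ adjacent Γ w w) u~w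

    nbdUnion-u : nbdUnion u ≡ true
    nbdUnion-u = trans (cong (adjacent Γ u u ∨_) (trans (symmetric Γ w u) u~w)) (∨-zeroʳ _)

    nbdUnion-¬IsRow : DisjointNbds Γ u w → ¬ IsRow Γ nbdUnion
    nbdUnion-¬IsRow disjoint (x , row≡) =
      disjoint x (adjacent-to u nbdUnion-u , adjacent-to w nbdUnion-w)
      where
      adjacent-to : ∀ y → nbdUnion y ≡ true → adjacent Γ y x ≡ true
      adjacent-to y y∈v = trans (symmetric Γ y x) (trans (sym (row≡ y)) y∈v)

theorem4p3 : ∀ {n : ℕ} (Γ : SimpleGraph n) → Connected Γ →
    (u w : Fin n) → u ≢ w → adjacent Γ u w ≡ true → DisjointNbds Γ u w →
    ∃ λ (v : Fin n → Bool) →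
      (∃ λ (j : Fin n) → v j ≡ true) ×
      InRowSpace Γ (λ j → toℚ (v j)) ×
      ¬ IsRow Γ v
theorem4p3 Γ _ u w _ u~w disjoint =
  nbdUnion Γ u w ,
  (w , nbdUnion-w Γ u w u~w) ,
  nbdUnion∈RowSpace Γ u w disjoint ,
  nbdUnion-¬IsRow Γ u w u~w disjoint
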